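{- Let $k\ge 2$, $r\ge 4$ and $rk\le n$. There exists a set $\mathcal{A}_0=\{x_1,\dots,x_r\}\subset\{0,1\}^n$ of $r$ vertices with all pairwise Hamming distances at most $2k$ such that the $r$-neighbor bootstrap percolation process on $Q_{n,k}$ started from $\mathcal{A}_0$ does not infect the entire graph.
   Context: $Q_{n,k}$ is the graph with vertex set $\{0,1\}^n$ in which $x,y$ are adjacent iff $1\le d_H(x,y)\le k$ ($d_H$ = Hamming distance). The $r$-neighbor bootstrap percolation process from $\mathcal{A}_0\subset V$: $\mathcal{A}_i=\mathcal{A}_{i-1}\cup\{v: |N_v\cap\mathcal{A}_{i-1}|\ge r\}$, where $N_v$ is the neighborhood of $v$; it percolates if $\mathcal{A}_i=V$ for some $i$. -}

module Defs where

open import Data.Bool using (Bool; true; false; _∧_; _∨_; _xor_; if_then_else_)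
open import Data.Nat using (ℕ; zero; suc; _+_; _≤ᵇ_)
open import Data.Vec using (Vec; []; _∷_)
open import Data.List using (List; []; _∷_; map; _++_; length; filter)
open import Data.Fin using (Fin)
open import Data.Product using (∃-syntax)
open import Relation.Binary.PropositionalEquality using (_≡_)
open import Relation.Nullary using (¬_)
open import Data.Bool using (T?)

Vertex : ℕ → Set
Vertex n = Vec Bool n

hamming : ∀ {n} → Vertex n → Vertex n → ℕ
hamming []       []       = 0
hamming (a ∷ xs) (b ∷ ys) = (if a xor b then 1 else 0) + hamming xs ys

allVertices : (n : ℕ) → List (Vertex n)
allVertices zero    = [] ∷ []
allVertices (suc n) = map (false ∷_) (allVertices n) ++ map (true ∷_) (allVertices n)

adjacent : ∀ {n} → ℕ → Vertex n → Vertex n → Bool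
adjacent k x y = (1 ≤ᵇ hamming x y) ∧ (hamming x y ≤ᵇ k)

VSet : ℕ → Set
VSet n = Vertex n → Bool

nbrCount : ∀ {n} → ℕ → VSet n → Vertex n → ℕ
nbrCount {n} k A v = length (filter (λ y → T? (adjacent k v y ∧ A y)) (allVertices n))

step : ∀ {n} → ℕ → ℕ → VSet n → VSet n
step k r A v = A v ∨ (r ≤ᵇ nbrCount k A v)

infected : ∀ {n} → ℕ → ℕ → VSet n → ℕ → VSet n
infected k r A zero    = A
infected k r A (suc i) = step k r (infected k r A i)

Percolates : ∀ {n} → ℕ → ℕ → VSet n → Set
Percolates {n} k r A = ∃[ i ] (∀ (v : Vertex n) → infected k r A i v ≡ true)

listMember : ∀ {n} → Vertex n → List (Vertex n) → Bool
listMember v []       = false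
listMember v (x ∷ xs) = vecEq v x ∨ listMember v xs
  where
  vecEq : ∀ {m} → Vertex m → Vertex m → Bool
  vecEq []       []       = true
  vecEq (a ∷ as) (b ∷ bs) = (if a then b else (if b then false else true)) ∧ vecEq as bs

setOf : ∀ {n r} → (Fin r → Vertex n) → VSet n
setOf {r = r} x v = listMember v (Data.List.tabulate x)

{-# OPTIONS --safe #-}
module Submission where

-- Take for x₁, …, x_r the indicator vectors of r disjoint k-sets and let S = {0, x₁, …, x_r}.
-- Since d(v, x) = |v| + |x| − 2|v ∩ x|, a vertex v within distance k of some xᵢ satisfies
-- |v| ≤ 2|v ∩ xᵢ|; as the xᵢ are disjoint, Σᵢ |v ∩ xᵢ| ≤ |v|, so a v ≠ 0 is adjacent to at
-- most two of them and has at most 3 < r neighbours in S. Hence S is never left by the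
-- process started inside it, and the all-ones vertex is never infected.

open import Defs
open import Data.Bool using (Bool; true; false; _∧_; _∨_; if_then_else_; T?)
open import Data.Bool.Properties using (∧-zeroʳ; ∨-zeroʳ; ∧-distribˡ-∨; T-≡)
open import Data.Nat using (ℕ; zero; suc; _+_; _*_; _≤_; _<_; _≤ᵇ_; z≤n; s≤s; >-nonZero)
open import Data.Nat.Properties
  using (≤-refl; ≤-reflexive; ≤-trans; m≤n⇒m≤1+n; n≤1+n; m≤m+n; +-suc; +-comm; +-assoc; +-identityʳ; +-mono-≤; +-monoˡ-≤; +-monoʳ-≤; +-cancelʳ-≤; *-distribʳ-+; *-distribˡ-+; *-monoʳ-≤; *-cancelʳ-≤; n>0⇒n≢0; n≢0⇒n>0; ≤ᵇ⇒≤; <-≤-trans; ≤-<-trans; <⇒≱; <⇒≢; *-comm; m<m*n; module ≤-Reasoning)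
open import Data.Nat.Solver using (module +-*-Solver)
open import Data.Fin using (Fin; zero; suc)
open import Data.Vec using ([]; _∷_; zipWith; replicate)
open import Data.List using (List; []; _∷_; map; _++_; length; filter; tabulate)
open import Data.List.Properties using (length-++; filter-++)
open import Data.List.Membership.Propositional using (_∈_)
open import Data.List.Membership.Propositional.Properties using (∈-tabulate⁻)
open import Data.List.Relation.Unary.Any using (here; there)
open import Data.Empty using (⊥-elim)
open import Relation.Nullary using (¬_)
open import Data.Product using (∃-syntax; _×_; _,_)
open import Function.Bundles using (Equivalence)
open import Function.Definitions using (Injective)
open import Relation.Binary.PropositionalEquality using (_≡_; _≢_; refl; cong; cong₂; trans; sym; module ≡-Reasoning)

open +-*-Solver using (solve; _:+_; _:*_; con; _:=_)

-- Written with the very body of the test local to listMember, so that the two agree definitionally.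
xnor : Bool → Bool → Bool
xnor a b = if a then b else (if b then false else true)

_≡ᵇ_ : ∀ {n} → Vertex n → Vertex n → Bool
[]      ≡ᵇ []      = true
(a ∷ u) ≡ᵇ (b ∷ v) = xnor a b ∧ (u ≡ᵇ v)

≡ᵇ-refl : ∀ {n} (v : Vertex n) → v ≡ᵇ v ≡ true
≡ᵇ-refl []          = refl
≡ᵇ-refl (true ∷ v)  = ≡ᵇ-refl v
≡ᵇ-refl (false ∷ v) = ≡ᵇ-refl v

≡ᵇ⇒≡ : ∀ {n} (u v : Vertex n) → u ≡ᵇ v ≡ true → u ≡ v
≡ᵇ⇒≡ []          []          _ = refl
≡ᵇ⇒≡ (true ∷ u)  (true ∷ v)  h = cong (true ∷_) (≡ᵇ⇒≡ u v h)
≡ᵇ⇒≡ (false ∷ u) (false ∷ v) h = cong (false ∷_) (≡ᵇ⇒≡ u v h)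

-- The equality test used by listMember is local to its where block and cannot be named.
-- It takes the clause variables v x xs as extra parameters, hence this type.
LocalTest : Set
LocalTest = ∀ {n} → Vertex n → Vertex n → List (Vertex n) → ∀ {m} → Vertex m → Vertex m → Bool

record IsListMemberTest (F : LocalTest) : Set where
  field
    unfold  : ∀ {n} (y l : Vertex n) L → listMember y (l ∷ L) ≡ F y l L y l ∨ listMember y L
    test-[] : ∀ {n} (v x : Vertex n) xs → F v x xs [] [] ≡ true
    test-∷  : ∀ {n} (v x : Vertex n) xs {m} a b (u w : Vertex m) →
              F v x xs (a ∷ u) (b ∷ w) ≡ xnor a b ∧ F v x xs u w

test≗≡ᵇ : ∀ {F : LocalTest} → IsListMemberTest F →
          ∀ {n} (v x : Vertex n) xs {m} (u w : Vertex m) → F v x xs u w ≡ u ≡ᵇ w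
test≗≡ᵇ isTest v x xs []      []      = IsListMemberTest.test-[] isTest v x xs
test≗≡ᵇ isTest v x xs (a ∷ u) (b ∷ w) =
  trans (IsListMemberTest.test-∷ isTest v x xs a b u w) (cong (xnor a b ∧_) (test≗≡ᵇ isTest v x xs u w))

-- The goal contains the local test as F (a ∷ u) (b ∷ w) L u w, from which unification cannot
-- read off F; abstracting a ∷ u, b ∷ w (and their length) makes that occurrence a pattern, and
-- the unfold field, checked by refl, lets Agda prune the dependence of F on the clause variables.
listMember-∷ : ∀ {n} (y l : Vertex n) L → listMember y (l ∷ L) ≡ (y ≡ᵇ l) ∨ listMember y L
listMember-∷ []      []      L = refl
listMember-∷ {suc n} (a ∷ u) (b ∷ w) L with suc n | a ∷ u | b ∷ w | L
... | N | v | x | xs = cong (λ t → xnor a b ∧ t ∨ listMember v xs) (test≗≡ᵇ isTest v x xs u w)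
  where
  isTest : IsListMemberTest _
  isTest = record { unfold = λ _ _ _ → refl ; test-[] = λ _ _ _ → refl ; test-∷ = λ _ _ _ _ _ _ _ → refl }

listMember⇒∈ : ∀ {n} (y : Vertex n) L → listMember y L ≡ true → y ∈ L
listMember⇒∈ y (l ∷ L) h with y ≡ᵇ l in y≡ᵇl | trans (sym (listMember-∷ y l L)) h
... | true  | _  = here (≡ᵇ⇒≡ y l y≡ᵇl)
... | false | h′ = there (listMember⇒∈ y L h′)

listMember-here : ∀ {n} (y : Vertex n) L → listMember y (y ∷ L) ≡ true
listMember-here y L = trans (listMember-∷ y y L) (cong (_∨ listMember y L) (≡ᵇ-refl y))

listMember-there : ∀ {n} (y l : Vertex n) L → listMember y L ≡ true → listMember y (l ∷ L) ≡ true
listMember-there y l L h = trans (listMember-∷ y l L) (trans (cong ((y ≡ᵇ l) ∨_) h) (∨-zeroʳ (y ≡ᵇ l)))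

∧-projʳ : ∀ a {b} → a ∧ b ≡ true → b ≡ true
∧-projʳ true h = h

count : ∀ {A : Set} → (A → Bool) → List A → ℕ
count p xs = length (filter (λ x → T? (p x)) xs)

module _ {A : Set} where

  count-mono : ∀ {p q : A → Bool} → (∀ x → p x ≡ true → q x ≡ true) → ∀ xs → count p xs ≤ count q xs
  count-mono         p⇒q []       = z≤n
  count-mono {p} {q} p⇒q (x ∷ xs) with p x in px | q x in qx
  ... | true  | true  = s≤s (count-mono p⇒q xs)
  ... | true  | false with () ← trans (sym (p⇒q x px)) qx
  ... | false | true  = m≤n⇒m≤1+n (count-mono p⇒q xs)
  ... | false | false = count-mono p⇒q xs

  count-none : ∀ {p : A → Bool} → (∀ x → p x ≡ false) → ∀ xs → count p xs ≡ 0
  count-none     none []       = refl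
  count-none {p} none (x ∷ xs) rewrite none x = count-none none xs

  count-∷ : ∀ (p : A → Bool) x xs → count p (x ∷ xs) ≡ (if p x then 1 else 0) + count p xs
  count-∷ p x xs with p x
  ... | true  = refl
  ... | false = refl

  count-∷-≤ : ∀ (p : A → Bool) x xs → count p (x ∷ xs) ≤ suc (count p xs)
  count-∷-≤ p x xs with p x
  ... | true  = ≤-refl
  ... | false = n≤1+n (count p xs)

  count-∨ : ∀ (p q : A → Bool) xs → count (λ x → p x ∨ q x) xs ≤ count p xs + count q xs
  count-∨ p q []       = z≤n
  count-∨ p q (x ∷ xs) with p x | q x
  ... | true  | true  = s≤s (≤-trans (m≤n⇒m≤1+n (count-∨ p q xs)) (≤-reflexive (sym (+-suc _ _))))
  ... | true  | false = s≤s (count-∨ p q xs)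
  ... | false | true  = ≤-trans (s≤s (count-∨ p q xs)) (≤-reflexive (sym (+-suc _ _)))
  ... | false | false = count-∨ p q xs

  count-++ : ∀ (p : A → Bool) xs ys → count p (xs ++ ys) ≡ count p xs + count p ys
  count-++ p xs ys = trans (cong length (filter-++ (λ x → T? (p x)) xs ys)) (length-++ (filter (λ x → T? (p x)) xs))

count-map : ∀ {A B : Set} (p : B → Bool) (f : A → B) xs → count p (map f xs) ≡ count (λ x → p (f x)) xs
count-map p f []       = refl
count-map p f (x ∷ xs) with p (f x)
... | true  = cong suc (count-map p f xs)
... | false = count-map p f xs

count-allVertices-suc : ∀ n (p : Vertex (suc n) → Bool) →
  count p (allVertices (suc n)) ≡ count (λ y → p (false ∷ y)) (allVertices n) + count (λ y → p (true ∷ y)) (allVertices n)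
count-allVertices-suc n p =
  trans (count-++ p (map (false ∷_) (allVertices n)) (map (true ∷_) (allVertices n)))
        (cong₂ _+_ (count-map p (false ∷_) (allVertices n)) (count-map p (true ∷_) (allVertices n)))

count-≡ᵇ-allVertices : ∀ n (l : Vertex n) → count (_≡ᵇ l) (allVertices n) ≡ 1
count-≡ᵇ-allVertices zero    []          = refl
count-≡ᵇ-allVertices (suc n) (false ∷ l) =
  trans (count-allVertices-suc n (_≡ᵇ (false ∷ l)))
        (cong₂ _+_ (count-≡ᵇ-allVertices n l) (count-none (λ _ → refl) (allVertices n)))
count-≡ᵇ-allVertices (suc n) (true ∷ l)  =
  trans (count-allVertices-suc n (_≡ᵇ (true ∷ l)))
        (cong₂ _+_ (count-none (λ _ → refl) (allVertices n)) (count-≡ᵇ-allVertices n l))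

module _ {n} {U : List (Vertex n)} (once : ∀ l → count (_≡ᵇ l) U ≤ 1) (P : Vertex n → Bool) where

  count-∧-≡ᵇ : ∀ l → count (λ y → P y ∧ (y ≡ᵇ l)) U ≤ (if P l then 1 else 0)
  count-∧-≡ᵇ l with P l in Pl
  ... | true  = ≤-trans (count-mono (λ y → ∧-projʳ (P y)) U) (once l)
  ... | false = ≤-reflexive (count-none ¬P∧≡ᵇ U)
    where
    ¬P∧≡ᵇ : ∀ y → P y ∧ (y ≡ᵇ l) ≡ false
    ¬P∧≡ᵇ y with y ≡ᵇ l in y≡ᵇl
    ... | false = ∧-zeroʳ (P y)
    ... | true  rewrite ≡ᵇ⇒≡ y l y≡ᵇl | Pl = refl

  count-∧-listMember : ∀ L → count (λ y → P y ∧ listMember y L) U ≤ count P L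
  count-∧-listMember []      = ≤-reflexive (count-none (λ y → ∧-zeroʳ (P y)) U)
  count-∧-listMember (l ∷ L) = begin
    count (λ y → P y ∧ listMember y (l ∷ L)) U
      ≤⟨ count-mono (λ y h → trans (unfold y) h) U ⟩
    count (λ y → (P y ∧ (y ≡ᵇ l)) ∨ (P y ∧ listMember y L)) U
      ≤⟨ count-∨ _ _ U ⟩
    count (λ y → P y ∧ (y ≡ᵇ l)) U + count (λ y → P y ∧ listMember y L) U
      ≤⟨ +-mono-≤ (count-∧-≡ᵇ l) (count-∧-listMember L) ⟩
    (if P l then 1 else 0) + count P L
      ≡⟨ count-∷ P l L ⟨
    count P (l ∷ L) ∎
    where
    open ≤-Reasoning
    unfold : ∀ y → (P y ∧ (y ≡ᵇ l)) ∨ (P y ∧ listMember y L) ≡ P y ∧ listMember y (l ∷ L)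
    unfold y = trans (sym (∧-distribˡ-∨ (P y) (y ≡ᵇ l) (listMember y L))) (cong (P y ∧_) (sym (listMember-∷ y l L)))

weight : ∀ {n} → Vertex n → ℕ
weight []          = 0
weight (true ∷ v)  = suc (weight v)
weight (false ∷ v) = weight v

_∩_ : ∀ {n} → Vertex n → Vertex n → Vertex n
_∩_ = zipWith _∧_

hamming+2*∣∩∣ : ∀ {n} (u v : Vertex n) → hamming u v + 2 * weight (u ∩ v) ≡ weight u + weight v
hamming+2*∣∩∣ []          []          = refl
hamming+2*∣∩∣ (true ∷ u)  (true ∷ v)  = begin
  hamming u v + 2 * suc (weight (u ∩ v))   ≡⟨ solve 2 (λ h w → h :+ con 2 :* (con 1 :+ w) := con 2 :+ (h :+ con 2 :* w)) refl (hamming u v) (weight (u ∩ v)) ⟩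
  2 + (hamming u v + 2 * weight (u ∩ v))   ≡⟨ cong (2 +_) (hamming+2*∣∩∣ u v) ⟩
  2 + (weight u + weight v)             ≡⟨ cong suc (+-suc (weight u) (weight v)) ⟨
  suc (weight u) + suc (weight v)       ∎
  where open ≡-Reasoning
hamming+2*∣∩∣ (true ∷ u)  (false ∷ v) = cong suc (hamming+2*∣∩∣ u v)
hamming+2*∣∩∣ (false ∷ u) (true ∷ v)  = trans (cong suc (hamming+2*∣∩∣ u v)) (sym (+-suc (weight u) (weight v)))
hamming+2*∣∩∣ (false ∷ u) (false ∷ v) = hamming+2*∣∩∣ u v

hamming≤weight+weight : ∀ {n} (u v : Vertex n) → hamming u v ≤ weight u + weight v
hamming≤weight+weight u v = ≤-trans (m≤m+n (hamming u v) _) (≤-reflexive (hamming+2*∣∩∣ u v))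

weight≤2*∣∩∣ : ∀ {n} (v l : Vertex n) → hamming v l ≤ weight l → weight v ≤ 2 * weight (v ∩ l)
weight≤2*∣∩∣ v l d≤wl = +-cancelʳ-≤ (weight l) (weight v) (2 * weight (v ∩ l)) (begin
  weight v + weight l                  ≡⟨ hamming+2*∣∩∣ v l ⟨
  hamming v l + 2 * weight (v ∩ l)     ≤⟨ +-monoˡ-≤ _ d≤wl ⟩
  weight l + 2 * weight (v ∩ l)        ≡⟨ +-comm (weight l) _ ⟩
  2 * weight (v ∩ l) + weight l        ∎)
  where open ≤-Reasoning

weight-∩-≤ : ∀ {n} (v u : Vertex n) → weight (v ∩ u) ≤ weight v
weight-∩-≤ []          []          = z≤n
weight-∩-≤ (true ∷ v)  (true ∷ u)  = s≤s (weight-∩-≤ v u)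
weight-∩-≤ (true ∷ v)  (false ∷ u) = m≤n⇒m≤1+n (weight-∩-≤ v u)
weight-∩-≤ (false ∷ v) (_ ∷ u)     = weight-∩-≤ v u

weight-∩-self : ∀ {n} (v : Vertex n) → weight (v ∩ v) ≡ weight v
weight-∩-self []          = refl
weight-∩-self (true ∷ v)  = cong suc (weight-∩-self v)
weight-∩-self (false ∷ v) = weight-∩-self v

weight≡0⇒≡zeros : ∀ {n} (v : Vertex n) → weight v ≡ 0 → v ≡ replicate n false
weight≡0⇒≡zeros []          _ = refl
weight≡0⇒≡zeros (false ∷ v) h = cong (false ∷_) (weight≡0⇒≡zeros v h)

weight-replicate : ∀ n b → weight (replicate n b) ≡ (if b then n else 0)
weight-replicate zero    true  = refl
weight-replicate zero    false = refl
weight-replicate (suc n) true  = cong suc (weight-replicate n true)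
weight-replicate (suc n) false = weight-replicate n false

-- block n a c has its ones exactly at the positions a, …, a + c - 1 that are below n.
block : (n a c : ℕ) → Vertex n
block zero    _       _       = []
block (suc n) (suc a) c       = false ∷ block n a c
block (suc n) zero    (suc c) = true ∷ block n zero c
block (suc n) zero    zero    = false ∷ block n zero zero

weight-block : ∀ n a c → a + c ≤ n → weight (block n a c) ≡ c
weight-block zero    zero    zero    _         = refl
weight-block (suc n) (suc a) c       (s≤s a+c≤n) = weight-block n a c a+c≤n
weight-block (suc n) zero    (suc c) (s≤s c≤n)   = cong suc (weight-block n zero c c≤n)
weight-block (suc n) zero    zero    _           = weight-block n zero zero z≤n

weight-∩-block-empty : ∀ {n} (v : Vertex n) a → weight (v ∩ block n a 0) ≡ 0
weight-∩-block-empty []      _       = refl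
weight-∩-block-empty (b ∷ v) zero    rewrite ∧-zeroʳ b = weight-∩-block-empty v zero
weight-∩-block-empty (b ∷ v) (suc a) rewrite ∧-zeroʳ b = weight-∩-block-empty v a

weight-∩-block-+ : ∀ {n} (v : Vertex n) a c m →
  weight (v ∩ block n a c) + weight (v ∩ block n (a + c) m) ≡ weight (v ∩ block n a (c + m))
weight-∩-block-+ []          a       c       m = refl
weight-∩-block-+ (b ∷ v)     (suc a) c       m rewrite ∧-zeroʳ b = weight-∩-block-+ v a c m
weight-∩-block-+ (true ∷ v)  zero    (suc c) m = cong suc (weight-∩-block-+ v zero c m)
weight-∩-block-+ (false ∷ v) zero    (suc c) m = weight-∩-block-+ v zero c m
weight-∩-block-+ v           zero    zero    m = cong (_+ weight (v ∩ block _ zero m)) (weight-∩-block-empty v zero)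

block-disjoint : ∀ n a c b d → a + c ≤ b → weight (block n b d ∩ block n a c) ≡ 0
block-disjoint zero    a       c       b       d _           = refl
block-disjoint (suc n) (suc a) c       (suc b) d (s≤s a+c≤b) = block-disjoint n a c b d a+c≤b
block-disjoint (suc n) zero    (suc c) (suc b) d (s≤s c≤b)   = block-disjoint n zero c b d c≤b
block-disjoint (suc n) zero    zero    b       d _           = weight-∩-block-empty (block (suc n) b d) zero

-- blockFamily n k a i = block n (a + i * k) k, recursive in i so that tabulate peels off one block at a time.
blockFamily : ∀ {r} (n k a : ℕ) → Fin r → Vertex n
blockFamily n k a zero    = block n a k
blockFamily n k a (suc i) = blockFamily n k (a + k) i

module _ {n k : ℕ} where

  first-fits : ∀ r a → a + suc r * k ≤ n → a + k ≤ n
  first-fits r a = ≤-trans (+-monoʳ-≤ a (m≤m+n k (r * k)))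

  rest-fits : ∀ r a → a + suc r * k ≤ n → a + k + r * k ≤ n
  rest-fits r a = ≤-trans (≤-reflexive (+-assoc a k (r * k)))

  weight-blockFamily : ∀ {r} a → a + r * k ≤ n → (i : Fin r) → weight (blockFamily n k a i) ≡ k
  weight-blockFamily {suc r} a bound zero    = weight-block n a k (first-fits r a bound)
  weight-blockFamily {suc r} a bound (suc i) = weight-blockFamily (a + k) (rest-fits r a bound) i

  blockFamily-disjoint : ∀ {r} a c b → a + c ≤ b → (j : Fin r) → weight (blockFamily n k b j ∩ block n a c) ≡ 0
  blockFamily-disjoint a c b a+c≤b zero    = block-disjoint n a c b k a+c≤b
  blockFamily-disjoint a c b a+c≤b (suc j) = blockFamily-disjoint a c (b + k) (≤-trans a+c≤b (m≤m+n b k)) j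

  block≢blockFamily : ∀ {r} a → 0 < k → a + k ≤ n → (j : Fin r) → block n a k ≢ blockFamily n k (a + k) j
  block≢blockFamily a 0<k a+k≤n j e = n>0⇒n≢0 0<k (begin
    k                                              ≡⟨ weight-block n a k a+k≤n ⟨
    weight (block n a k)                           ≡⟨ weight-∩-self (block n a k) ⟨
    weight (block n a k ∩ block n a k)             ≡⟨ cong (λ u → weight (u ∩ block n a k)) e ⟩
    weight (blockFamily n k (a + k) j ∩ block n a k) ≡⟨ blockFamily-disjoint a k (a + k) ≤-refl j ⟩
    0                                              ∎)
    where open ≡-Reasoning

  blockFamily-injective : ∀ {r} a → 0 < k → a + r * k ≤ n → Injective _≡_ _≡_ (blockFamily {r} n k a)
  blockFamily-injective {suc r} a 0<k bound {zero}  {zero}  _ = refl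
  blockFamily-injective {suc r} a 0<k bound {suc i} {suc j} e =
    cong suc (blockFamily-injective (a + k) 0<k (rest-fits r a bound) e)
  blockFamily-injective {suc r} a 0<k bound {zero}  {suc j} e = ⊥-elim (block≢blockFamily a 0<k (first-fits r a bound) j e)
  blockFamily-injective {suc r} a 0<k bound {suc i} {zero}  e = ⊥-elim (block≢blockFamily a 0<k (first-fits r a bound) i (sym e))

adjacent⇒hamming≤ : ∀ {n} k (v l : Vertex n) → adjacent k v l ≡ true → hamming v l ≤ k
adjacent⇒hamming≤ k v l adj = ≤ᵇ⇒≤ (hamming v l) k (Equivalence.from T-≡ (∧-projʳ (1 ≤ᵇ hamming v l) adj))

module _ {n k : ℕ} (v : Vertex n) where

  adjacent-indicator-bound : ∀ l → weight l ≡ k →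
    (if adjacent k v l then 1 else 0) * weight v ≤ 2 * weight (v ∩ l)
  adjacent-indicator-bound l wl≡k with adjacent k v l in adj
  ... | false = z≤n
  ... | true  = ≤-trans (≤-reflexive (+-identityʳ (weight v)))
                  (weight≤2*∣∩∣ v l (≤-trans (adjacent⇒hamming≤ k v l adj) (≤-reflexive (sym wl≡k))))

  count-adjacent-blockFamily : ∀ r a → a + r * k ≤ n →
    count (adjacent k v) (tabulate (blockFamily {r} n k a)) * weight v ≤ 2 * weight (v ∩ block n a (r * k))
  count-adjacent-blockFamily zero    a _     = z≤n
  count-adjacent-blockFamily (suc r) a bound = begin
    count (adjacent k v) (x₀ ∷ rest) * weight v
      ≡⟨ cong (_* weight v) (count-∷ (adjacent k v) x₀ rest) ⟩
    (δ + count (adjacent k v) rest) * weight v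
      ≡⟨ *-distribʳ-+ (weight v) δ _ ⟩
    δ * weight v + count (adjacent k v) rest * weight v
      ≤⟨ +-mono-≤ (adjacent-indicator-bound x₀ (weight-block n a k (first-fits r a bound)))
                  (count-adjacent-blockFamily r (a + k) (rest-fits r a bound)) ⟩
    2 * weight (v ∩ x₀) + 2 * weight (v ∩ block n (a + k) (r * k))
      ≡⟨ *-distribˡ-+ 2 (weight (v ∩ x₀)) _ ⟨
    2 * (weight (v ∩ x₀) + weight (v ∩ block n (a + k) (r * k)))
      ≡⟨ cong (2 *_) (weight-∩-block-+ v a k (r * k)) ⟩
    2 * weight (v ∩ block n a (k + r * k)) ∎
    where
    open ≤-Reasoning
    x₀ = block n a k
    δ = if adjacent k v x₀ then 1 else 0
    rest = tabulate (blockFamily {r} n k (a + k))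

  count-adjacent-blockFamily≤2 : ∀ r → r * k ≤ n → 0 < weight v → count (adjacent k v) (tabulate (blockFamily {r} n k 0)) ≤ 2
  count-adjacent-blockFamily≤2 r rk≤n 0<w = *-cancelʳ-≤ _ 2 (weight v) {{>-nonZero 0<w}}
    (≤-trans (count-adjacent-blockFamily r 0 rk≤n) (*-monoʳ-≤ 2 (weight-∩-≤ v (block n 0 (r * k)))))

_⊆_ : ∀ {n} → VSet n → VSet n → Set
A ⊆ B = ∀ v → A v ≡ true → B v ≡ true

IsClosed : ∀ {n} → ℕ → ℕ → VSet n → Set
IsClosed k r S = ∀ v → S v ≡ false → nbrCount k S v < r

nbrCount-mono : ∀ {n} k {A B : VSet n} → A ⊆ B → ∀ v → nbrCount k A v ≤ nbrCount k B v
nbrCount-mono {n} k {A} {B} A⊆B v = count-mono adjacent-∧-⊆ (allVertices n)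
  where
  adjacent-∧-⊆ : ∀ y → adjacent k v y ∧ A y ≡ true → adjacent k v y ∧ B y ≡ true
  adjacent-∧-⊆ y h with adjacent k v y
  ... | true = A⊆B y h

module _ {n : ℕ} (k r : ℕ) {S : VSet n} (closed : IsClosed k r S) where

  step-⊆ : ∀ {A} → A ⊆ S → step k r A ⊆ S
  step-⊆ {A} A⊆S v h with S v in Sv | A v in Av
  ... | true  | _     = refl
  ... | false | true  = trans (sym Sv) (A⊆S v Av)
  ... | false | false = ⊥-elim (<⇒≱ (closed v Sv)
                          (≤-trans (≤ᵇ⇒≤ r _ (Equivalence.from T-≡ h)) (nbrCount-mono k A⊆S v)))

  infected-⊆ : ∀ {A} → A ⊆ S → ∀ t → infected k r A t ⊆ S
  infected-⊆ A⊆S zero    = A⊆S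
  infected-⊆ A⊆S (suc t) = step-⊆ (infected-⊆ A⊆S t)

  closed⇒¬percolates : ∀ {A} → A ⊆ S → ∀ v → S v ≢ true → ¬ Percolates k r A
  closed⇒¬percolates A⊆S v v∉S (t , all) = v∉S (infected-⊆ A⊆S t v (all v))

module Construction (n k r : ℕ) (2≤k : 2 ≤ k) (4≤r : 4 ≤ r) (rk≤n : r * k ≤ n) where

  x : Fin r → Vertex n
  x = blockFamily n k 0

  zeros ones : Vertex n
  zeros = replicate n false
  ones  = replicate n true

  S : VSet n
  S v = listMember v (zeros ∷ tabulate x)

  0<k : 0 < k
  0<k = ≤-trans (s≤s z≤n) 2≤k

  k<n : k < n
  k<n = <-≤-trans (m<m*n k r {{>-nonZero 0<k}} (≤-trans (s≤s (s≤s z≤n)) 4≤r))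
                  (≤-trans (≤-reflexive (*-comm k r)) rk≤n)

  weight-x : ∀ i → weight (x i) ≡ k
  weight-x = weight-blockFamily 0 rk≤n

  x-injective : Injective _≡_ _≡_ x
  x-injective = blockFamily-injective 0 0<k rk≤n

  hamming-x≤2k : ∀ i j → hamming (x i) (x j) ≤ 2 * k
  hamming-x≤2k i j = begin
    hamming (x i) (x j)         ≤⟨ hamming≤weight+weight (x i) (x j) ⟩
    weight (x i) + weight (x j) ≡⟨ cong₂ _+_ (weight-x i) (weight-x j) ⟩
    k + k                       ≡⟨ cong (k +_) (+-identityʳ k) ⟨
    2 * k                       ∎
    where open ≤-Reasoning

  setOf-x⊆S : setOf x ⊆ S
  setOf-x⊆S v = listMember-there v zeros (tabulate x)

  S-closed : IsClosed k r S
  S-closed v Sv = begin-strict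
    nbrCount k S v                                  ≤⟨ count-∧-listMember {U = allVertices n} once (adjacent k v) (zeros ∷ tabulate x) ⟩
    count (adjacent k v) (zeros ∷ tabulate x)       ≤⟨ count-∷-≤ (adjacent k v) zeros (tabulate x) ⟩
    suc (count (adjacent k v) (tabulate x))         ≤⟨ s≤s (count-adjacent-blockFamily≤2 v r rk≤n 0<weight) ⟩
    3                                               <⟨ 4≤r ⟩
    r                                               ∎
    where
    open ≤-Reasoning
    once : ∀ l → count (_≡ᵇ l) (allVertices n) ≤ 1
    once l = ≤-reflexive (count-≡ᵇ-allVertices n l)
    v≢zeros : v ≢ zeros
    v≢zeros refl with () ← trans (sym Sv) (listMember-here zeros (tabulate x))
    0<weight : 0 < weight v
    0<weight = n≢0⇒n>0 (λ w≡0 → v≢zeros (weight≡0⇒≡zeros v w≡0))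

  ones≡⇒n≡weight : ∀ {u} → ones ≡ u → n ≡ weight u
  ones≡⇒n≡weight refl = sym (weight-replicate n true)

  ones∉S : S ones ≢ true
  ones∉S h with listMember⇒∈ ones (zeros ∷ tabulate x) h
  ... | here ones≡zeros = n>0⇒n≢0 (≤-<-trans z≤n k<n) (trans (ones≡⇒n≡weight ones≡zeros) (weight-replicate n false))
  ... | there ones∈x with i , ones≡xi ← ∈-tabulate⁻ ones∈x = <⇒≢ k<n (sym (trans (ones≡⇒n≡weight ones≡xi) (weight-x i)))

lemma3p6 : ∀ (n k r : ℕ) → 2 ≤ k → 4 ≤ r → r * k ≤ n →
    ∃[ x ] (Injective _≡_ _≡_ x
      × (∀ (i j : Fin r) → hamming {n} (x i) (x j) ≤ 2 * k)
      × ¬ Percolates k r (setOf x))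
lemma3p6 n k r 2≤k 4≤r rk≤n =
  x , x-injective , hamming-x≤2k , closed⇒¬percolates k r S-closed setOf-x⊆S ones ones∉S
  where open Construction n k r 2≤k 4≤r rk≤n
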